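{- For all $n\ge2$ and $1\le k\le n$, the number of U-words $u$ of length $n$ with $u_{n-1}+u_n=k$ equals $E_{n,k}$.
   Context: $E_{n,k}$ is the number of permutations $\pi$ of $\{1,\dots,n\}$ with $\pi_1>\pi_2<\pi_3>\cdots$ and $\pi_1=k$. A U-word of length $n$ is a sequence $u=(u_1,\dots,u_n)$ of positive integers with $u_1=1$ and $u_i+u_{i-1}\le i$ for $2\le i\le n$. -}

module Defs where

open import Data.Bool using (Bool; true; false; _∧_; not; T)
open import Data.Nat using (ℕ; zero; suc; _+_; _≤ᵇ_; _<ᵇ_; _≡ᵇ_)
open import Data.Vec using (Vec; []; _∷_; lookup)

-- Sequences (x₁,…,xₙ) are stored as Vec ℕ n (position i ↔ index i-1).
-- All predicates are Bool-valued and used through T, so that their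
-- proofs are unique and counting elements of the Σ-sets below is
-- counting the underlying sequences.

-- U-word check on the remainder xs, whose first entry is at position i
-- (1-based); p is the entry at position i-1.
uTail : ∀ {m} → ℕ → ℕ → Vec ℕ m → Bool
uTail i p [] = true
uTail i p (x ∷ xs) = (1 ≤ᵇ x) ∧ (x + p ≤ᵇ i) ∧ uTail (suc i) x xs

-- u is a U-word: positive integer entries, u₁ = 1, and
-- uᵢ + uᵢ₋₁ ≤ i for 2 ≤ i ≤ n.
isUWord : ∀ {n} → Vec ℕ n → Bool
isUWord [] = true
isUWord (x ∷ xs) = (x ≡ᵇ 1) ∧ uTail 2 x xs

lastTwoSum : ∀ {n} → Vec ℕ (suc (suc n)) → ℕ
lastTwoSum (a ∷ b ∷ []) = a + b
lastTwoSum (a ∷ b ∷ c ∷ xs) = lastTwoSum (b ∷ c ∷ xs)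

notIn : ∀ {m} → ℕ → Vec ℕ m → Bool
notIn x [] = true
notIn x (y ∷ ys) = not (x ≡ᵇ y) ∧ notIn x ys

allDistinct : ∀ {m} → Vec ℕ m → Bool
allDistinct [] = true
allDistinct (x ∷ xs) = notIn x xs ∧ allDistinct xs

inRange : ∀ {m} → ℕ → Vec ℕ m → Bool
inRange n [] = true
inRange n (x ∷ xs) = (1 ≤ᵇ x) ∧ (x ≤ᵇ n) ∧ inRange n xs

isPerm : ∀ {n} → Vec ℕ n → Bool
isPerm {n} π = inRange n π ∧ allDistinct π

-- Alternating pattern π₁ > π₂ < π₃ > ⋯ .
-- d = true: the next comparison must be a descent.
altFrom : ∀ {m} → Bool → ℕ → Vec ℕ m → Bool
altFrom d p [] = true
altFrom true  p (x ∷ xs) = (x <ᵇ p) ∧ altFrom false x xs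
altFrom false p (x ∷ xs) = (p <ᵇ x) ∧ altFrom true x xs

isDownUp : ∀ {n} → Vec ℕ n → Bool
isDownUp [] = true
isDownUp (x ∷ xs) = altFrom true x xs

head? : ∀ {n} → Vec ℕ n → ℕ → Bool
head? [] k = false
head? (x ∷ xs) k = x ≡ᵇ k

open import Data.Product using (Σ)

-- U-words of length n with u_{n-1} + u_n = k  (n = m+2).
UWords : (m k : ℕ) → Set
UWords m k = Σ (Vec ℕ (suc (suc m))) λ u → T (isUWord u ∧ (lastTwoSum u ≡ᵇ k))

-- Permutations π of {1,…,n} with π₁ > π₂ < π₃ > ⋯ and π₁ = k.
-- E_{n,k} is the cardinality of this set.
AltPerms : (n k : ℕ) → Set
AltPerms n k = Σ (Vec ℕ n) λ π → T (isPerm π ∧ isDownUp π ∧ head? π k)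

-- Let U(n, c) be the number of U-words of length n ending in c. The letter c may follow
-- b at position n + 1 exactly when b + c ≤ n + 1, so deleting the last letter gives
-- U(n + 1, c) = Σ_{b ≤ n+1-c} U(n, b). The same deletion matches both the U-words of
-- length n with u_{n-1} + u_n = k and those ending in n + 1 - k with the U-words of
-- length n - 1 ending in some b < k, so each set has U(n, n+1-k) elements.
-- On the other side, deleting π₁ = k from a down-up permutation, standardising the
-- remaining values to {1, …, n-1} and complementing them is a bijection onto the down-up
-- permutations of length n - 1 starting with n - b for some b < k (namely b = π₂). Hence
-- E_{n,k} = Σ_{b<k} E_{n-1,n-b}, the same recursion, and E_{n,k} = U(n, n+1-k) too.
module Submission where

open import Defs
open import Data.Bool using (Bool; true; false; T; _∧_; not; if_then_else_)
open import Data.Bool.Properties using (T-∧; T-≡; T-not-≡; T-irrelevant; ∧-assoc; ∧-identityʳ)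
open import Data.Empty using (⊥-elim)
import Data.Fin as Fin
open Fin using (Fin)
open import Data.Fin.Properties using (+↔⊎)
open import Data.Nat using (ℕ; zero; suc; pred; _+_; _∸_; _≤_; _<_; _≤ᵇ_; _<ᵇ_; _≡ᵇ_; _<?_)
open import Data.Nat using (z≤n; s≤s; z<s; s<s⁻¹; >-nonZero)
open import Data.Nat.Properties
open import Data.Product using (Σ; _×_; _,_; proj₁; proj₂)
open import Data.Sum using (_⊎_; inj₁; inj₂)
open import Data.Sum.Function.Propositional using (_⊎-↔_)
open import Data.Vec using (Vec; []; _∷_; _∷ʳ_; init; last; initLast; map; head; tail)
open import Data.Vec.Properties using (init-∷ʳ; last-∷ʳ)
open import Data.Vec.Relation.Unary.All as All using (All; []; _∷_)
open import Data.Vec.Relation.Unary.All.Properties using (map⁺)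
open import Function using (_∘_)
open import Function.Bundles using (_↔_; mk↔ₛ′; Inverse; Equivalence)
open import Function.Properties.Inverse using (↔-refl; ↔-sym; ↔-trans)
open import Function.Related.Propositional using (≡⇒; module EquationalReasoning; bijection)
open import Relation.Binary.Definitions using (tri<; tri≈; tri>)
open import Relation.Binary.PropositionalEquality
open import Relation.Nullary using (¬_; yes; no)

private
  variable
    A B : Set
    r n : ℕ

∧-elim : ∀ {a b} → T (a ∧ b) → T a × T b
∧-elim = Equivalence.to T-∧

∧-intro : ∀ {a b} → T a → T b → T (a ∧ b)
∧-intro p q = Equivalence.from T-∧ (p , q)

T-injective : ∀ {a b} → (T a → T b) → (T b → T a) → a ≡ b
T-injective {false} {false} _ _ = refl
T-injective {false} {true}  _ g = ⊥-elim (g _)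
T-injective {true}  {false} f _ = ⊥-elim (f _)
T-injective {true}  {true}  _ _ = refl

if-< : ∀ {m n} {x y : A} → m < n → (if m <ᵇ n then x else y) ≡ x
if-< m<n rewrite Equivalence.to T-≡ (<⇒<ᵇ m<n) = refl

if-≥ : ∀ {m n} {x y : A} → n ≤ m → (if m <ᵇ n then x else y) ≡ y
if-≥ {m = m} {n} n≤m with m <ᵇ n in eq
... | true  = ⊥-elim (<⇒≱ (<ᵇ⇒< m n (subst T (sym eq) _)) n≤m)
... | false = refl

subset-≡ : {P : A → Bool} {x y : Σ A (λ a → T (P a))} → proj₁ x ≡ proj₁ y → x ≡ y
subset-≡ {x = a , p} {y = .a , q} refl = cong (a ,_) (T-irrelevant p q)

subset↔subset : {P : A → Bool} {Q : B → Bool} (f : A → B) (g : B → A) →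
  (∀ x → T (P x) → T (Q (f x))) → (∀ y → T (Q y) → T (P (g y))) →
  (∀ y → T (Q y) → f (g y) ≡ y) → (∀ x → T (P x) → g (f x) ≡ x) →
  Σ A (λ x → T (P x)) ↔ Σ B (λ y → T (Q y))
subset↔subset f g f-ok g-ok fg gf = mk↔ₛ′
  (λ (x , p) → f x , f-ok x p) (λ (y , q) → g y , g-ok y q)
  (λ (y , q) → subset-≡ (fg y q)) (λ (x , p) → subset-≡ (gf x p))

Σ< : ℕ → (ℕ → Set) → Set
Σ< r X = Σ ℕ λ j → j < r × X j

∑< : ℕ → (ℕ → ℕ) → ℕ
∑< zero    h = 0
∑< (suc r) h = h 0 + ∑< r (h ∘ suc)

Σ<-cong : {X Y : ℕ → Set} → (∀ {j} → j < r → X j ↔ Y j) → Σ< r X ↔ Σ< r Y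
Σ<-cong X↔Y = mk↔ₛ′
  (λ (j , j<r , x) → j , j<r , Inverse.to (X↔Y j<r) x)
  (λ (j , j<r , y) → j , j<r , Inverse.from (X↔Y j<r) y)
  (λ (j , j<r , y) → cong (λ y → j , j<r , y) (Inverse.strictlyInverseˡ (X↔Y j<r) y))
  (λ (j , j<r , x) → cong (λ x → j , j<r , x) (Inverse.strictlyInverseʳ (X↔Y j<r) x))

Σ<-suc↔ : (X : ℕ → Set) → Σ< (suc r) X ↔ (X 0 ⊎ Σ< r (X ∘ suc))
Σ<-suc↔ X = mk↔ₛ′
  (λ { (zero , _ , x) → inj₁ x ; (suc j , s≤s j<r , x) → inj₂ (j , j<r , x) })
  (λ { (inj₁ x) → 0 , s≤s z≤n , x ; (inj₂ (j , j<r , x)) → suc j , s≤s j<r , x })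
  (λ { (inj₁ x) → refl ; (inj₂ y) → refl })
  (λ { (zero , s≤s z≤n , x) → refl ; (suc j , s≤s j<r , x) → refl })

Fin-∑<↔ : ∀ r (h : ℕ → ℕ) → Fin (∑< r h) ↔ Σ< r (Fin ∘ h)
Fin-∑<↔ zero    h = mk↔ₛ′ (λ ()) (λ { (_ , () , _) }) (λ { (_ , () , _) }) (λ ())
Fin-∑<↔ (suc r) h = begin
  Fin (h 0 + ∑< r (h ∘ suc))           ↔⟨ +↔⊎ ⟩
  (Fin (h 0) ⊎ Fin (∑< r (h ∘ suc)))   ↔⟨ ↔-refl ⊎-↔ Fin-∑<↔ r (h ∘ suc) ⟩
  (Fin (h 0) ⊎ Σ< r (Fin ∘ h ∘ suc))   ↔⟨ Σ<-suc↔ (Fin ∘ h) ⟨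
  Σ< (suc r) (Fin ∘ h)                 ∎
  where open EquationalReasoning {k = bijection}

subset↔Σ<-subsets : {P : A → Bool} {Q : ℕ → B → Bool}
  (f : A → B) (index : A → ℕ) (g : B → A) →
  (∀ x → T (P x) → index x < r × T (Q (index x) (f x))) →
  (∀ j y → j < r → T (Q j y) → T (P (g y))) →
  (∀ j y → j < r → T (Q j y) → index (g y) ≡ j × f (g y) ≡ y) →
  (∀ x → T (P x) → g (f x) ≡ x) →
  Σ A (λ x → T (P x)) ↔ Σ< r (λ j → Σ B (λ y → T (Q j y)))
subset↔Σ<-subsets {B = B} {r = r} {Q = Q} f index g f-ok g-ok fg gf = mk↔ₛ′
  (λ (x , p) → index x , proj₁ (f-ok x p) , f x , proj₂ (f-ok x p))
  (λ (j , j<r , y , q) → g y , g-ok j y j<r q)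
  (λ (j , j<r , y , q) → Σ<-≡ (fg j y j<r q))
  (λ (x , p) → subset-≡ (gf x p))
  where
  Σ<-≡ : ∀ {j j′ y y′ j<r j′<r q q′} → j ≡ j′ × y ≡ y′ →
    _≡_ {A = Σ< r (λ j → Σ B (λ y → T (Q j y)))} (j , j<r , y , q) (j′ , j′<r , y′ , q′)
  Σ<-≡ (refl , refl) = cong₂ (λ j<r q → _ , j<r , _ , q) (<-irrelevant _ _) (T-irrelevant _ _)

module _ {c k N : ℕ} (c+k≡1+N : c + k ≡ suc N) where

  +c≤⇒< : ∀ {b} → b + c ≤ N → b < k
  +c≤⇒< {b} b+c≤N = +-cancelʳ-≤ c (suc b) k
    (≤-trans (s≤s b+c≤N) (≤-reflexive (trans (sym c+k≡1+N) (+-comm c k))))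

  <⇒+c≤ : ∀ {b} → b < k → b + c ≤ N
  <⇒+c≤ {b} b<k = ≤-pred
    (≤-trans (+-monoˡ-≤ c b<k) (≤-reflexive (trans (+-comm k c) c+k≡1+N)))

∷ʳ-init-last : (u : Vec A (suc n)) → init u ∷ʳ last u ≡ u
∷ʳ-init-last u = sym (proj₂ (proj₂ (initLast u)))

map-inverse : {P : A → Set} {f : A → B} {g : B → A} → (∀ {x} → P x → g (f x) ≡ x) →
  ∀ {m} {xs : Vec A m} → All P xs → map g (map f xs) ≡ xs
map-inverse gf []         = refl
map-inverse gf (px ∷ pxs) = cong₂ _∷_ (gf px) (map-inverse gf pxs)

-- U-words

appendable : ℕ → ℕ → ℕ → Bool
appendable i b x = (1 ≤ᵇ x) ∧ (x + b ≤ᵇ i)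

uTail-∷ʳ : ∀ {m} i p (xs : Vec ℕ m) x →
  uTail i p (xs ∷ʳ x) ≡ uTail i p xs ∧ appendable (i + m) (last (p ∷ xs)) x
uTail-∷ʳ i p [] x rewrite +-identityʳ i = cong ((1 ≤ᵇ x) ∧_) (∧-identityʳ _)
uTail-∷ʳ {suc m} i p (y ∷ ys) x rewrite uTail-∷ʳ (suc i) y ys x | +-suc i m =
  trans (cong ((1 ≤ᵇ y) ∧_) (sym (∧-assoc (y + p ≤ᵇ i) _ _))) (sym (∧-assoc (1 ≤ᵇ y) _ _))

isUWord-∷ʳ : (w : Vec ℕ (suc n)) (x : ℕ) →
  isUWord (w ∷ʳ x) ≡ isUWord w ∧ appendable (2 + n) (last w) x
isUWord-∷ʳ (y ∷ ys) x rewrite uTail-∷ʳ 2 y ys x = sym (∧-assoc (y ≡ᵇ 1) _ _)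

isUWord-∷ʳ⁻ : (w : Vec ℕ (suc n)) (x : ℕ) → T (isUWord (w ∷ʳ x)) →
  T (isUWord w) × 1 ≤ x × last w + x ≤ 2 + n
isUWord-∷ʳ⁻ {n} w x p with ∧-elim (subst T (isUWord-∷ʳ w x) p)
... | w-ok , x-ok with ∧-elim x-ok
... | 1≤x , bound =
  w-ok , ≤ᵇ⇒≤ 1 x 1≤x , subst (_≤ 2 + n) (+-comm x (last w)) (≤ᵇ⇒≤ (x + last w) (2 + n) bound)

isUWord-∷ʳ⁺ : (w : Vec ℕ (suc n)) (x : ℕ) →
  T (isUWord w) → 1 ≤ x → last w + x ≤ 2 + n → T (isUWord (w ∷ʳ x))
isUWord-∷ʳ⁺ {n} w x w-ok 1≤x bound = subst T (sym (isUWord-∷ʳ w x))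
  (∧-intro w-ok (∧-intro (≤⇒≤ᵇ 1≤x) (≤⇒≤ᵇ (subst (_≤ 2 + n) (+-comm (last w) x) bound))))

isUWord-init⁻ : (u : Vec ℕ (2 + n)) → T (isUWord u) →
  T (isUWord (init u)) × 1 ≤ last u × last (init u) + last u ≤ 2 + n
isUWord-init⁻ u p =
  isUWord-∷ʳ⁻ (init u) (last u) (subst (T ∘ isUWord) (sym (∷ʳ-init-last u)) p)

isUWord⇒1≤last : (w : Vec ℕ (suc n)) → T (isUWord w) → 1 ≤ last w
isUWord⇒1≤last {zero}  (y ∷ []) p = ≤-reflexive (sym (≡ᵇ⇒≡ y 1 (proj₁ (∧-elim p))))
isUWord⇒1≤last {suc n} w p = proj₁ (proj₂ (isUWord-init⁻ w p))

lastTwoSum-∷ʳ : (w : Vec ℕ (suc n)) (x : ℕ) → lastTwoSum (w ∷ʳ x) ≡ last w + x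
lastTwoSum-∷ʳ (y ∷ [])         x = refl
lastTwoSum-∷ʳ (y ∷ z ∷ [])     x = refl
lastTwoSum-∷ʳ (y ∷ z ∷ v ∷ vs) x = lastTwoSum-∷ʳ (z ∷ v ∷ vs) x

lastTwoSum-init-last : (u : Vec ℕ (2 + n)) → lastTwoSum u ≡ last (init u) + last u
lastTwoSum-init-last u =
  trans (cong lastTwoSum (sym (∷ʳ-init-last u))) (lastTwoSum-∷ʳ (init u) (last u))

-- Length n + 1, as in UWords; countEndingIn n c is U(n + 1, c) in the notation above.
UWordsEndingIn : ℕ → ℕ → Set
UWordsEndingIn n c = Σ (Vec ℕ (suc n)) λ u → T (isUWord u ∧ (last u ≡ᵇ c))

module _ {m k c : ℕ} (c+k≡3+m : c + k ≡ 3 + m) where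

  private
    k+c≡3+m : k + c ≡ 3 + m
    k+c≡3+m = trans (+-comm k c) c+k≡3+m

    setLast : ℕ → Vec ℕ (2 + m) → Vec ℕ (2 + m)
    setLast x u = init u ∷ʳ x

    completeTo-k : Vec ℕ (2 + m) → Vec ℕ (2 + m)
    completeTo-k v = setLast (k ∸ last (init v)) v

    b+x≡k : ∀ (u : Vec ℕ (2 + m)) → T (lastTwoSum u ≡ᵇ k) → last (init u) + last u ≡ k
    b+x≡k u p = trans (sym (lastTwoSum-init-last u)) (≡ᵇ⇒≡ _ k p)

    setLast-ok : ∀ u → T (isUWord u ∧ (lastTwoSum u ≡ᵇ k)) →
      T (isUWord (setLast c u) ∧ (last (setLast c u) ≡ᵇ c))
    setLast-ok u p with ∧-elim p
    ... | u-ok , sum with isUWord-init⁻ u u-ok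
    ... | w-ok , 1≤x , b+x≤2+m = ∧-intro
      (isUWord-∷ʳ⁺ (init u) c w-ok
        (+c≤⇒< k+c≡3+m (subst (_≤ 2 + m) (b+x≡k u sum) b+x≤2+m))
        (<⇒+c≤ c+k≡3+m (subst (last (init u) <_) (b+x≡k u sum) (m<m+n _ 1≤x))))
      (≡⇒≡ᵇ _ c (last-∷ʳ c (init u)))

    completeTo-k-ok : ∀ v → T (isUWord v ∧ (last v ≡ᵇ c)) →
      T (isUWord (completeTo-k v) ∧ (lastTwoSum (completeTo-k v) ≡ᵇ k))
    completeTo-k-ok v q with ∧-elim q
    ... | v-ok , end with isUWord-init⁻ v v-ok
    ... | w-ok , 1≤last , b+last≤2+m = ∧-intro
      (isUWord-∷ʳ⁺ w (k ∸ b) w-ok (m<n⇒0<n∸m b<k)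
        (subst (_≤ 2 + m) (sym b+[k∸b]≡k) (<⇒+c≤ k+c≡3+m (subst (1 ≤_) last≡c 1≤last))))
      (≡⇒≡ᵇ _ k (trans (lastTwoSum-∷ʳ w (k ∸ b)) b+[k∸b]≡k))
      where
      w = init v
      b = last w
      last≡c : last v ≡ c
      last≡c = ≡ᵇ⇒≡ _ c end
      b<k : b < k
      b<k = +c≤⇒< c+k≡3+m (subst (λ x → b + x ≤ 2 + m) last≡c b+last≤2+m)
      b+[k∸b]≡k : b + (k ∸ b) ≡ k
      b+[k∸b]≡k = m+[n∸m]≡n (<⇒≤ b<k)

    setLast-completeTo-k : ∀ v → T (isUWord v ∧ (last v ≡ᵇ c)) → setLast c (completeTo-k v) ≡ v
    setLast-completeTo-k v q = begin
      init (init v ∷ʳ _) ∷ʳ c  ≡⟨ cong (_∷ʳ c) (init-∷ʳ _ (init v)) ⟩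
      init v ∷ʳ c              ≡⟨ cong (init v ∷ʳ_) (≡ᵇ⇒≡ _ c (proj₂ (∧-elim q))) ⟨
      init v ∷ʳ last v         ≡⟨ ∷ʳ-init-last v ⟩
      v                        ∎
      where open ≡-Reasoning

    completeTo-k-setLast : ∀ u → T (isUWord u ∧ (lastTwoSum u ≡ᵇ k)) →
      completeTo-k (setLast c u) ≡ u
    completeTo-k-setLast u p = begin
      completeTo-k (init u ∷ʳ c)
        ≡⟨ cong (λ w → w ∷ʳ (k ∸ last w)) (init-∷ʳ c (init u)) ⟩
      init u ∷ʳ (k ∸ last (init u))
        ≡⟨ cong (λ k → init u ∷ʳ (k ∸ last (init u))) (b+x≡k u (proj₂ (∧-elim p))) ⟨
      init u ∷ʳ (last (init u) + last u ∸ last (init u))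
        ≡⟨ cong (init u ∷ʳ_) (m+n∸m≡n (last (init u)) (last u)) ⟩
      init u ∷ʳ last u
        ≡⟨ ∷ʳ-init-last u ⟩
      u ∎
      where open ≡-Reasoning

  UWords↔UWordsEndingIn : UWords m k ↔ UWordsEndingIn (suc m) c
  UWords↔UWordsEndingIn = subset↔subset (setLast c) completeTo-k
    setLast-ok completeTo-k-ok setLast-completeTo-k completeTo-k-setLast

module _ {n c r : ℕ} (1≤c : 1 ≤ c) (c+r≡2+n : c + r ≡ 2 + n) where

  private
    index : Vec ℕ (2 + n) → ℕ
    index u = pred (last (init u))

    init-ok : ∀ u → T (isUWord u ∧ (last u ≡ᵇ c)) →
      index u < r × T (isUWord (init u) ∧ (last (init u) ≡ᵇ suc (index u)))
    init-ok u p with ∧-elim p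
    ... | u-ok , end with isUWord-init⁻ u u-ok
    ... | w-ok , _ , b+x≤2+n =
      +c≤⇒< c+r≡2+n (≤-pred (subst₂ (λ b x → b + x ≤ 2 + n) (sym sb≡b) (≡ᵇ⇒≡ _ c end) b+x≤2+n)) ,
      ∧-intro w-ok (≡⇒≡ᵇ _ _ (sym sb≡b))
      where
      b = last (init u)
      sb≡b : suc (pred b) ≡ b
      sb≡b = suc-pred b {{>-nonZero (isUWord⇒1≤last (init u) w-ok)}}

    ∷ʳ-ok : ∀ j w → j < r → T (isUWord w ∧ (last w ≡ᵇ suc j)) →
      T (isUWord (w ∷ʳ c) ∧ (last (w ∷ʳ c) ≡ᵇ c))
    ∷ʳ-ok j w j<r q with ∧-elim q
    ... | w-ok , end = ∧-intro
      (isUWord-∷ʳ⁺ w c w-ok 1≤c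
        (subst (λ b → b + c ≤ 2 + n) (sym (≡ᵇ⇒≡ _ _ end)) (s≤s (<⇒+c≤ c+r≡2+n j<r))))
      (≡⇒≡ᵇ _ c (last-∷ʳ c w))

  UWordsEndingIn-suc↔ : UWordsEndingIn (suc n) c ↔ Σ< r (λ j → UWordsEndingIn n (suc j))
  UWordsEndingIn-suc↔ = subset↔Σ<-subsets init index (_∷ʳ c) init-ok ∷ʳ-ok
    (λ j w _ q → cong pred (trans (cong last (init-∷ʳ c w)) (≡ᵇ⇒≡ _ _ (proj₂ (∧-elim q)))) ,
                 init-∷ʳ c w)
    (λ u p → trans (cong (init u ∷ʳ_) (sym (≡ᵇ⇒≡ _ c (proj₂ (∧-elim p))))) (∷ʳ-init-last u))

countEndingIn : ℕ → ℕ → ℕ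
countEndingIn zero    (suc zero) = 1
countEndingIn zero    _          = 0
countEndingIn (suc n) c          = ∑< (2 + n ∸ c) (λ j → countEndingIn n (suc j))

UWordsEndingIn↔Fin : ∀ n {c} → 1 ≤ c → c ≤ suc n → UWordsEndingIn n c ↔ Fin (countEndingIn n c)
UWordsEndingIn↔Fin zero (s≤s z≤n) (s≤s z≤n) = mk↔ₛ′
  (λ _ → Fin.zero) (λ _ → 1 ∷ [] , _) (λ { Fin.zero → refl ; (Fin.suc ()) })
  (λ { (x ∷ [] , p) → subset-≡ (cong (_∷ []) (sym (≡ᵇ⇒≡ x 1 (proj₂ (∧-elim p))))) })
UWordsEndingIn↔Fin (suc n) {c@(suc c′)} 1≤c c≤2+n = begin
  UWordsEndingIn (suc n) c
    ↔⟨ UWordsEndingIn-suc↔ 1≤c (m+[n∸m]≡n c≤2+n) ⟩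
  Σ< (suc n ∸ c′) (λ j → UWordsEndingIn n (suc j))
    ↔⟨ Σ<-cong (λ j<r → UWordsEndingIn↔Fin n (s≤s z≤n) (≤-trans j<r (m∸n≤m (suc n) c′))) ⟩
  Σ< (suc n ∸ c′) (λ j → Fin (countEndingIn n (suc j)))
    ↔⟨ Fin-∑<↔ (suc n ∸ c′) (λ j → countEndingIn n (suc j)) ⟨
  Fin (countEndingIn (suc n) c) ∎
  where open EquationalReasoning {k = bijection}

-- Down-up permutations

InRange : ℕ → ℕ → Set
InRange N z = 1 ≤ z × z ≤ N

-- Data.Fin's punchOut and punchIn, on ℕ.
punchOut : ℕ → ℕ → ℕ
punchOut k z = if z <ᵇ k then z else pred z

punchIn : ℕ → ℕ → ℕ
punchIn k v = if v <ᵇ k then v else suc v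

punchOut-< : ∀ {k z} → z < k → punchOut k z ≡ z
punchOut-< = if-<

punchOut-> : ∀ {k z} → k < z → punchOut k z ≡ pred z
punchOut-> k<z = if-≥ (<⇒≤ k<z)

punchIn-< : ∀ {k v} → v < k → punchIn k v ≡ v
punchIn-< = if-<

punchIn-≥ : ∀ {k v} → k ≤ v → punchIn k v ≡ suc v
punchIn-≥ = if-≥

punchOut-punchIn : ∀ k v → punchOut k (punchIn k v) ≡ v
punchOut-punchIn k v with v <? k
... | yes v<k = trans (cong (punchOut k) (punchIn-< v<k)) (punchOut-< v<k)
... | no  v≮k = trans (cong (punchOut k) (punchIn-≥ (≮⇒≥ v≮k))) (punchOut-> (s≤s (≮⇒≥ v≮k)))

punchOut-mono : ∀ {k a b} → a ≢ k → b ≢ k → a < b → punchOut k a < punchOut k b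
punchOut-mono {k} {a} {b} a≢k b≢k a<b with <-cmp a k | <-cmp b k
... | tri≈ _ a≡k _ | _            = ⊥-elim (a≢k a≡k)
... | _            | tri≈ _ b≡k _ = ⊥-elim (b≢k b≡k)
... | tri> _ _ k<a | tri< b<k _ _ = ⊥-elim (<-asym (<-trans b<k k<a) a<b)
... | tri< a<k _ _ | tri< b<k _ _ = subst₂ _<_ (sym (punchOut-< a<k)) (sym (punchOut-< b<k)) a<b
... | tri< a<k _ _ | tri> _ _ k<b =
  subst₂ _<_ (sym (punchOut-< a<k)) (sym (punchOut-> k<b)) (<-≤-trans a<k (<⇒≤pred k<b))
... | tri> _ _ k<a | tri> _ _ k<b = subst₂ _<_ (sym (punchOut-> k<a)) (sym (punchOut-> k<b))
  (pred-mono-< {{>-nonZero (<-≤-trans z<s k<a)}} a<b)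

complement : ℕ → ℕ → ℕ
complement M v = suc M ∸ v

complement-range : ∀ {M v} → InRange M v → InRange M (complement M v)
complement-range {M} (1≤v , v≤M) = m<n⇒0<n∸m (s≤s v≤M) , ∸-monoʳ-≤ (suc M) 1≤v

complement-involutive : ∀ {M v} → v ≤ suc M → complement M (complement M v) ≡ v
complement-involutive = m∸[m∸n]≡n

complement-antitone : ∀ {M a b} → a < b → b ≤ suc M → complement M b < complement M a
complement-antitone = ∸-monoʳ-<

complement-∸ : ∀ {M j} → j ≤ M → complement M (M ∸ j) ≡ suc j
complement-∸ {M} {j} j≤M = trans (+-∸-assoc 1 (m∸n≤m M j)) (cong suc (m∸[m∸n]≡n j≤M))

-- The values of π₂ … πₙ when π₁ = k, and their relabelling: standardise, then complement.
module Relabel {M k : ℕ} (1≤k : 1 ≤ k) (k≤1+M : k ≤ suc M) where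

  Entry : ℕ → Set
  Entry z = InRange (suc M) z × z ≢ k

  reduce : ℕ → ℕ
  reduce = complement M ∘ punchOut k

  expand : ℕ → ℕ
  expand = punchIn k ∘ complement M

  punchOut-range : ∀ {z} → Entry z → InRange M (punchOut k z)
  punchOut-range {z} ((1≤z , z≤1+M) , z≢k) with <-cmp z k
  ... | tri< z<k _ _ =
    subst (InRange M) (sym (punchOut-< z<k)) (1≤z , ≤-pred (<-≤-trans z<k k≤1+M))
  ... | tri≈ _ z≡k _ = ⊥-elim (z≢k z≡k)
  ... | tri> _ _ k<z =
    subst (InRange M) (sym (punchOut-> k<z)) (≤-trans 1≤k (<⇒≤pred k<z) , pred-mono-≤ z≤1+M)

  punchIn-range : ∀ {v} → InRange M v → Entry (punchIn k v)
  punchIn-range {v} (1≤v , v≤M) with v <? k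
  ... | yes v<k = subst Entry (sym (punchIn-< v<k)) ((1≤v , m≤n⇒m≤1+n v≤M) , <⇒≢ v<k)
  ... | no  v≮k = subst Entry (sym (punchIn-≥ (≮⇒≥ v≮k)))
    ((s≤s z≤n , s≤s v≤M) , ≢-sym (<⇒≢ (s≤s (≮⇒≥ v≮k))))

  punchIn-punchOut : ∀ {z} → Entry z → punchIn k (punchOut k z) ≡ z
  punchIn-punchOut {z} (_ , z≢k) with <-cmp z k
  ... | tri< z<k _ _ = trans (cong (punchIn k) (punchOut-< z<k)) (punchIn-< z<k)
  ... | tri≈ _ z≡k _ = ⊥-elim (z≢k z≡k)
  ... | tri> _ _ k<z@(s≤s k≤z′) = trans (cong (punchIn k) (punchOut-> k<z)) (punchIn-≥ k≤z′)

  reduce-range : ∀ {z} → Entry z → InRange M (reduce z)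
  reduce-range = complement-range ∘ punchOut-range

  expand-range : ∀ {w} → InRange M w → Entry (expand w)
  expand-range = punchIn-range ∘ complement-range

  expand-reduce : ∀ {z} → Entry z → expand (reduce z) ≡ z
  expand-reduce e = trans
    (cong (punchIn k) (complement-involutive (m≤n⇒m≤1+n (proj₂ (punchOut-range e)))))
    (punchIn-punchOut e)

  reduce-expand : ∀ {w} → InRange M w → reduce (expand w) ≡ w
  reduce-expand (_ , w≤M) =
    trans (cong (complement M) (punchOut-punchIn k _)) (complement-involutive (m≤n⇒m≤1+n w≤M))

  reduce-antitone : ∀ {a b} → Entry a → Entry b → a < b → reduce b < reduce a
  reduce-antitone (_ , a≢k) eb@(_ , b≢k) a<b = complement-antitone
    (punchOut-mono a≢k b≢k a<b) (m≤n⇒m≤1+n (proj₂ (punchOut-range eb)))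

module Antitone {D : ℕ → Set} {φ : ℕ → ℕ}
  (antitone : ∀ {a b} → D a → D b → a < b → φ b < φ a) where

  reflects-< : ∀ {a b} → D a → D b → φ b < φ a → a < b
  reflects-< {a} {b} da db φb<φa with <-cmp a b
  ... | tri< a<b _ _  = a<b
  ... | tri≈ _ refl _ = ⊥-elim (<-irrefl refl φb<φa)
  ... | tri> _ _ b<a  = ⊥-elim (<-asym φb<φa (antitone db da b<a))

  injective : ∀ {a b} → D a → D b → φ a ≡ φ b → a ≡ b
  injective {a} {b} da db φa≡φb with <-cmp a b
  ... | tri< a<b _ _ = ⊥-elim (<⇒≢ (antitone da db a<b) (sym φa≡φb))
  ... | tri≈ _ a≡b _ = a≡b
  ... | tri> _ _ b<a = ⊥-elim (<⇒≢ (antitone db da b<a) φa≡φb)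

  <ᵇ-flip : ∀ {a b} → D a → D b → (φ b <ᵇ φ a) ≡ (a <ᵇ b)
  <ᵇ-flip {a} {b} da db = T-injective
    (<⇒<ᵇ ∘ reflects-< da db ∘ <ᵇ⇒< (φ b) (φ a)) (<⇒<ᵇ ∘ antitone da db ∘ <ᵇ⇒< a b)

  ≡ᵇ-map : ∀ {a b} → D a → D b → (φ a ≡ᵇ φ b) ≡ (a ≡ᵇ b)
  ≡ᵇ-map {a} {b} da db = T-injective
    (≡⇒≡ᵇ a b ∘ injective da db ∘ ≡ᵇ⇒≡ (φ a) (φ b)) (≡⇒≡ᵇ (φ a) (φ b) ∘ cong φ ∘ ≡ᵇ⇒≡ a b)

  notIn-map : ∀ {m x} {xs : Vec ℕ m} → D x → All D xs → notIn (φ x) (map φ xs) ≡ notIn x xs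
  notIn-map dx []         = refl
  notIn-map dx (dy ∷ dys) = cong₂ (λ e r → not e ∧ r) (≡ᵇ-map dx dy) (notIn-map dx dys)

  allDistinct-map : ∀ {m} {xs : Vec ℕ m} → All D xs → allDistinct (map φ xs) ≡ allDistinct xs
  allDistinct-map []         = refl
  allDistinct-map (dx ∷ dxs) = cong₂ _∧_ (notIn-map dx dxs) (allDistinct-map dxs)

  altFrom-map : ∀ t {m p} {xs : Vec ℕ m} → D p → All D xs →
    altFrom (not t) (φ p) (map φ xs) ≡ altFrom t p xs
  altFrom-map t     dp []         = refl
  altFrom-map true  dp (dx ∷ dxs) = cong₂ _∧_ (<ᵇ-flip dx dp) (altFrom-map false dx dxs)
  altFrom-map false dp (dx ∷ dxs) = cong₂ _∧_ (<ᵇ-flip dp dx) (altFrom-map true dx dxs)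

inRange⁻ : ∀ {N m} (xs : Vec ℕ m) → T (inRange N xs) → All (InRange N) xs
inRange⁻ []       _ = []
inRange⁻ {N} (x ∷ xs) p with ∧-elim p
... | 1≤x , rest with ∧-elim rest
... | x≤N , rest′ = (≤ᵇ⇒≤ 1 x 1≤x , ≤ᵇ⇒≤ x N x≤N) ∷ inRange⁻ xs rest′

inRange⁺ : ∀ {N m} {xs : Vec ℕ m} → All (InRange N) xs → T (inRange N xs)
inRange⁺ []                  = _
inRange⁺ ((1≤x , x≤N) ∷ rxs) = ∧-intro (≤⇒≤ᵇ 1≤x) (∧-intro (≤⇒≤ᵇ x≤N) (inRange⁺ rxs))

notIn⁻ : ∀ {x m} (ys : Vec ℕ m) → T (notIn x ys) → All (_≢ x) ys
notIn⁻ []       _ = []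
notIn⁻ {x} (y ∷ ys) p with ∧-elim p
... | x≢y , rest = (λ y≡x → x≢y′ (≡⇒≡ᵇ x y (sym y≡x))) ∷ notIn⁻ ys rest
  where
  x≢y′ : ¬ T (x ≡ᵇ y)
  x≢y′ = subst T (Equivalence.to T-not-≡ x≢y)

notIn⁺ : ∀ {x m} {ys : Vec ℕ m} → All (_≢ x) ys → T (notIn x ys)
notIn⁺ []                               = _
notIn⁺ {x} {ys = y ∷ _} (y≢x ∷ ys≢x) = ∧-intro
  (Equivalence.from T-not-≡ (T-injective (λ t → y≢x (sym (≡ᵇ⇒≡ x y t))) λ ()))
  (notIn⁺ ys≢x)

IsAltPerm : ℕ → Vec ℕ n → Bool
IsAltPerm v σ = isPerm σ ∧ isDownUp σ ∧ head? σ v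

altPerm⁻ : ∀ v w (ws : Vec ℕ n) → T (IsAltPerm v (w ∷ ws)) →
  All (InRange (suc n)) (w ∷ ws) × T (allDistinct (w ∷ ws)) × T (altFrom true w ws) × w ≡ v
altPerm⁻ v w ws p with ∧-elim p
... | perm , rest with ∧-elim perm | ∧-elim rest
... | range , distinct | alt , hd = inRange⁻ (w ∷ ws) range , distinct , alt , ≡ᵇ⇒≡ w v hd

altPerm⁺ : ∀ {v w} {ws : Vec ℕ n} → All (InRange (suc n)) (w ∷ ws) → T (allDistinct (w ∷ ws)) →
  T (altFrom true w ws) → w ≡ v → T (IsAltPerm v (w ∷ ws))
altPerm⁺ range distinct alt w≡v =
  ∧-intro (∧-intro (inRange⁺ range) distinct) (∧-intro alt (≡⇒≡ᵇ _ _ w≡v))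

module _ {n k : ℕ} (k<2+n : k < 2 + n) where
  open Relabel {suc n} {suc k} (s≤s z≤n) k<2+n
  open Antitone reduce-antitone

  private
    altPerm-tail⁻ : ∀ x y (ys : Vec ℕ n) → T (IsAltPerm (suc k) (x ∷ y ∷ ys)) →
      x ≡ suc k × All Entry (y ∷ ys) × T (allDistinct (y ∷ ys)) × y < suc k × T (altFrom false y ys)
    altPerm-tail⁻ x y ys p with altPerm⁻ (suc k) x (y ∷ ys) p
    ... | _ ∷ range , distinct , alt , x≡1+k with ∧-elim distinct | ∧-elim alt
    ... | x∉ , distinct′ | y<x , alt′ =
      x≡1+k ,
      All.zip (range , subst (λ x → All (_≢ x) (y ∷ ys)) x≡1+k (notIn⁻ (y ∷ ys) x∉)) ,
      distinct′ , subst (y <_) x≡1+k (<ᵇ⇒< y x y<x) , alt′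

    index : Vec ℕ (2 + n) → ℕ
    index π = pred (head (tail π))

    reduceTail : Vec ℕ (2 + n) → Vec ℕ (suc n)
    reduceTail π = map reduce (tail π)

    expandCons : Vec ℕ (suc n) → Vec ℕ (2 + n)
    expandCons σ = suc k ∷ map expand σ

    expand-head : ∀ {j w} → j < k → w ≡ suc n ∸ j → expand w ≡ suc j
    expand-head {j} j<k refl = trans
      (cong (punchIn (suc k)) (complement-∸ (≤-trans (<⇒≤ j<k) (≤-pred k<2+n))))
      (punchIn-< (s≤s j<k))

    reduceTail-ok : ∀ π → T (IsAltPerm (suc k) π) →
      index π < k × T (IsAltPerm (suc n ∸ index π) (reduceTail π))
    reduceTail-ok (x ∷ y ∷ ys) p with altPerm-tail⁻ x y ys p
    ... | _ , es@(ey@((s≤s z≤n , _) , _) ∷ eys) , distinct , y<1+k , alt =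
      s<s⁻¹ y<1+k ,
      altPerm⁺ (map⁺ (All.map reduce-range es))
        (subst T (sym (allDistinct-map es)) distinct)
        (subst T (sym (altFrom-map false ey eys)) alt)
        (cong (complement (suc n)) (punchOut-< y<1+k))

    expandCons-ok : ∀ j σ → j < k → T (IsAltPerm (suc n ∸ j) σ) →
      T (IsAltPerm (suc k) (expandCons σ))
    expandCons-ok j (w ∷ ws) j<k q with altPerm⁻ (suc n ∸ j) w ws q
    ... | range@(rw ∷ rws) , distinct , alt , w≡ = altPerm⁺
      ((s≤s z≤n , k<2+n) ∷ map⁺ (All.map (proj₁ ∘ expand-range) range))
      (∧-intro (notIn⁺ (map⁺ (All.map (proj₂ ∘ expand-range) range))) distinct′)
      (∧-intro (subst (λ z → T (z <ᵇ suc k)) (sym (expand-head j<k w≡)) (<⇒<ᵇ (s≤s j<k))) alt′)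
      refl
      where
      es : All Entry (map expand (w ∷ ws))
      es = map⁺ (All.map expand-range range)
      distinct′ : T (allDistinct (map expand (w ∷ ws)))
      distinct′ = subst T
        (trans (cong allDistinct (sym (map-inverse reduce-expand range))) (allDistinct-map es))
        distinct
      alt′ : T (altFrom false (expand w) (map expand ws))
      alt′ = subst T
        (trans (sym (cong₂ (altFrom true) (reduce-expand rw) (map-inverse reduce-expand rws)))
               (altFrom-map false (expand-range rw) (map⁺ (All.map expand-range rws))))
        alt

    expandCons-inverse : ∀ j σ → j < k → T (IsAltPerm (suc n ∸ j) σ) →
      index (expandCons σ) ≡ j × reduceTail (expandCons σ) ≡ σ
    expandCons-inverse j (w ∷ ws) j<k q =
      let range , _ , _ , w≡ = altPerm⁻ (suc n ∸ j) w ws q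
      in cong pred (expand-head j<k w≡) , map-inverse reduce-expand range

    reduceTail-inverse : ∀ π → T (IsAltPerm (suc k) π) → expandCons (reduceTail π) ≡ π
    reduceTail-inverse (x ∷ y ∷ ys) p =
      let x≡1+k , es , _ = altPerm-tail⁻ x y ys p
      in cong₂ _∷_ (sym x≡1+k) (map-inverse expand-reduce es)

  AltPerms-suc↔ : AltPerms (2 + n) (suc k) ↔ Σ< k (λ j → AltPerms (suc n) (suc n ∸ j))
  AltPerms-suc↔ = subset↔Σ<-subsets reduceTail index expandCons
    reduceTail-ok expandCons-ok expandCons-inverse reduceTail-inverse

AltPerms↔Fin : ∀ n {k} → 1 ≤ k → k ≤ suc n →
  AltPerms (suc n) k ↔ Fin (countEndingIn n (2 + n ∸ k))
AltPerms↔Fin zero (s≤s z≤n) (s≤s z≤n) = mk↔ₛ′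
  (λ _ → Fin.zero) (λ _ → 1 ∷ [] , _) (λ { Fin.zero → refl ; (Fin.suc ()) })
  (λ { (x ∷ [] , p) → subset-≡ (cong (_∷ []) (sym (proj₂ (proj₂ (proj₂ (altPerm⁻ 1 x [] p)))))) })
AltPerms↔Fin (suc n) {suc k} _ k<2+n = begin
  AltPerms (2 + n) (suc k)
    ↔⟨ AltPerms-suc↔ k<2+n ⟩
  Σ< k (λ j → AltPerms (suc n) (suc n ∸ j))
    ↔⟨ Σ<-cong (λ {j} j<k → AltPerms↔Fin n (m<n⇒0<n∸m (j<1+n j<k)) (m∸n≤m (suc n) j)) ⟩
  Σ< k (λ j → Fin (countEndingIn n (2 + n ∸ (suc n ∸ j))))
    ↔⟨ Σ<-cong (λ j<k → ≡⇒ (cong (Fin ∘ countEndingIn n) (complement-∸ (<⇒≤ (j<1+n j<k))))) ⟩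
  Σ< k (λ j → Fin (countEndingIn n (suc j)))
    ↔⟨ Fin-∑<↔ k (λ j → countEndingIn n (suc j)) ⟨
  Fin (∑< k (λ j → countEndingIn n (suc j)))
    ≡⟨ cong (λ r → Fin (∑< r (λ j → countEndingIn n (suc j)))) (m∸[m∸n]≡n (<⇒≤ k<2+n)) ⟨
  Fin (countEndingIn (suc n) (2 + n ∸ k)) ∎
  where
  open EquationalReasoning {k = bijection}
  j<1+n : ∀ {j} → j < k → j < suc n
  j<1+n j<k = <-≤-trans j<k (≤-pred k<2+n)

theorem12 : (m k : ℕ) → 1 ≤ k → k ≤ suc (suc m) →
    Σ ℕ (λ N → (Fin N ↔ UWords m k) × (Fin N ↔ AltPerms (suc (suc m)) k))
theorem12 m k 1≤k k≤2+m = countEndingIn (suc m) c , ↔-sym words , ↔-sym perms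
  where
  c = 3 + m ∸ k
  words : UWords m k ↔ Fin (countEndingIn (suc m) c)
  words = ↔-trans (UWords↔UWordsEndingIn (m∸n+n≡m (m≤n⇒m≤1+n k≤2+m)))
    (UWordsEndingIn↔Fin (suc m) (m<n⇒0<n∸m (s≤s k≤2+m)) (∸-monoʳ-≤ (3 + m) 1≤k))
  perms : AltPerms (2 + m) k ↔ Fin (countEndingIn (suc m) c)
  perms = AltPerms↔Fin (suc m) 1≤k k≤2+m
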